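{- For every word $w=z_{k_1}\cdots z_{k_n}$ of length $n\geq 1$ with $k=k_1+\cdots+k_n$, \[\frac{d}{dt}S^t(C(w))=\begin{cases}0&(n=1),\\ S^t(C(\delta(w)))&(n\geq 2),\end{cases}\qquad \frac{d}{dt}S^t(\Sigma(w))=\begin{cases}(k-1)z_{k+1}&(n=1),\\ S^t(\Sigma(\delta(w)))-S^t(C(w))&(n\geq 2).\end{cases}\]
   Context: $\mathfrak{h}^1=\mathbb{Q}\langle z_1,z_2,\ldots\rangle$ is the non-commutative polynomial algebra on letters $z_k$ ($k\geq 1$), with $z_k\circ z_l=z_{k+l}$ extended to an action on $\mathfrak{h}^1[t]$ by $z_k\circ 1=0$, $z_k\circ(z_lw)=z_{k+l}w$ and linearity. $S^t$ is the $\mathbb{Q}[t]$-linear operator on $\mathfrak{h}^1[t]$ with $S^t(1)=1$ and $S^t(z_kw)=z_kS^t(w)+t\,z_k\circ S^t(w)$ for words $w$. For a word $w=z_{k_1}\cdots z_{k_n}$ ($n\geq1$) define $C(w)=\sum_{l=1}^n z_{k_l+1}z_{k_{l+1}}\cdots z_{k_n}z_{k_1}\cdots z_{k_{l-1}}$, $\Sigma(w)=\sum_{l=1}^n\sum_{j=1}^{k_l-1}z_{k_l+1-j}z_{k_{l+1}}\cdots z_{k_n}z_{k_1}\cdots z_{k_{l-1}}z_j$, and, if $n\geq2$, with $k_{n+1}:=k_1$, $\delta(w)=\sum_{l=1}^n z_{k_l+k_{l+1}}z_{k_{l+2}}\cdots z_{k_n}z_{k_1}\cdots z_{k_{l-1}}$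 (the cyclic word read starting after the merged pair, indices taken cyclically). These are extended $\mathbb{Q}[t]$-linearly. -}

module Defs where

open import Data.Nat as ℕ using (ℕ; zero; suc; _∸_)
open import Data.Integer using (+_)
open import Data.Rational as ℚ using (ℚ; _/_; 0ℚ; 1ℚ)
open import Data.List using (List; []; _∷_; _++_; map; concatMap; foldr; take; drop; length; upTo; filter; [_])
open import Data.List.Properties using (≡-dec)
open import Data.Product using (_×_; _,_)
open import Relation.Binary.PropositionalEquality using (_≡_)
open import Relation.Nullary using (yes; no)

-- A word z_{k_1} ⋯ z_{k_n} is the list k_1 ∷ ⋯ ∷ k_n ∷ [] (letters k ≥ 1 are
-- imposed as a hypothesis where needed).
Word : Set
Word = List ℕ

record Term : Set where
  constructor term
  field
    coef  : ℚ
    tpow  : ℕ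
    word  : Word

-- Elements of h¹[t] = ℚ⟨z₁,z₂,…⟩[t] as finite formal sums of monomials.
Poly : Set
Poly = List Term

ℕ→ℚ : ℕ → ℚ
ℕ→ℚ n = (+ n) / 1

coeff : Poly → ℕ → Word → ℚ
coeff [] m u = 0ℚ
coeff (term c e v ∷ p) m u with e ℕ.≟ m | ≡-dec ℕ._≟_ v u
... | yes _ | yes _ = c ℚ.+ coeff p m u
... | _     | _     = coeff p m u

infix 4 _≈_
_≈_ : Poly → Poly → Set
p ≈ q = ∀ m u → coeff p m u ≡ coeff q m u

zeroP : Poly
zeroP = []

infixl 6 _⊕_ _⊖_
_⊕_ : Poly → Poly → Poly
p ⊕ q = p ++ q

scale : ℚ → ℕ → Poly → Poly
scale c m = map (λ { (term c' e v) → term (c ℚ.* c') (m ℕ.+ e) v })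

_⊖_ : Poly → Poly → Poly
p ⊖ q = p ⊕ scale (ℚ.- 1ℚ) 0 q

word↑ : Word → Poly
word↑ w = term 1ℚ 0 w ∷ []

linExt : (Word → Poly) → Poly → Poly
linExt f = concatMap (λ { (term c e v) → scale c e (f v) })

ddt : Poly → Poly
ddt = map (λ { (term c e v) → term (c ℚ.* ℕ→ℚ e) (e ∸ 1) v })

zmul : ℕ → Poly → Poly
zmul k = map (λ { (term c e v) → term c e (k ∷ v) })

circ : ℕ → Poly → Poly
circ k [] = []
circ k (term c e [] ∷ p) = circ k p
circ k (term c e (l ∷ v) ∷ p) = term c e ((k ℕ.+ l) ∷ v) ∷ circ k p

Stw : Word → Poly
Stw [] = word↑ []
Stw (k ∷ w) = zmul k (Stw w) ⊕ scale 1ℚ 1 (circ k (Stw w))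

St : Poly → Poly
St = linExt Stw

-- cyclic rotation starting at (0-based) position l: k_{l+1} ⋯ k_n k_1 ⋯ k_l
rot : ℕ → Word → Word
rot l w = drop l w ++ take l w

cycSum : (Word → Poly) → Word → Poly
cycSum f w = concatMap (λ l → f (rot l w)) (upTo (length w))

-- C(w) = Σ_l z_{k_l+1} z_{k_{l+1}} ⋯ z_{k_n} z_{k_1} ⋯ z_{k_{l-1}}
Cw : Word → Poly
Cw = cycSum (λ { [] → [] ; (a ∷ r) → word↑ (suc a ∷ r) })

-- Σ(w) = Σ_l Σ_{j=1}^{k_l - 1} z_{k_l+1-j} z_{k_{l+1}} ⋯ z_{k_{l-1}} z_j
Σw : Word → Poly
Σw = cycSum (λ { [] → []
               ; (a ∷ r) → concatMap (λ i → word↑ ((a ∸ suc i) ℕ.+ 1 ∷ r ++ [ suc i ])) (upTo (a ∸ 1)) })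

-- δ(w) = Σ_l z_{k_l + k_{l+1}} z_{k_{l+2}} ⋯ z_{k_n} z_{k_1} ⋯ z_{k_{l-1}}  (n ≥ 2, cyclic)
δw : Word → Poly
δw = cycSum (λ { (a ∷ b ∷ r) → word↑ ((a ℕ.+ b) ∷ r) ; _ → [] })

C Σ δ : Poly → Poly
C = linExt Cw
Σ = linExt Σw
δ = linExt δw

module Submission where

-- The proof rests on one analytic fact and two counting identities.  The analytic
-- fact is the derivation rule  d/dt S^t(v) = Σᵢ S^t(mergeᵢ v),  where mergeᵢ v
-- replaces the adjacent letters z_a z_b at positions i, i+1 of v by z_{a+b}; it
-- follows by induction on v from the recursion of S^t and the Leibniz rule for
-- A + t·X.  Since C(w), Σ(w) and δ(w) are sums of words with coefficient 1, we
-- represent them as lists of words (Cˡ, Σˡ, δˡ); the theorem then reduces to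
-- identities between multisets of words (lists up to permutation), for n ≥ 2:
--   merges of the C-summands of w            =  C-summands of the δ-summands of w,
--   merges of the Σ-summands of w  +  Cˡ w   =  Σ-summands of the δ-summands of w.
-- Both are reindexings of finite double sums over the rotations of w.  For n = 1
-- a single letter has no merges, and each Σ-summand z_{k-j} z_j merges to z_{k+1}.

open import Defs
open import Agda.Builtin.Int using (pos)
open import Data.Empty using (⊥-elim)
import Data.Integer as ℤ
import Data.Integer.Properties as ℤP
open import Data.List as L using (List; []; _∷_; _++_; map; concat; concatMap; applyUpTo; upTo; length; [_]; reverse; take; drop)
import Data.List.Properties as LP
open import Data.List.Properties using (≡-dec)
open import Data.List.Relation.Binary.Permutation.Propositional
  using (_↭_; refl; prep; swap; trans; ↭-sym; ↭-trans; ↭-reflexive; module PermutationReasoning)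
import Data.List.Relation.Binary.Permutation.Propositional.Properties as PermP
open import Data.List.Relation.Unary.All as All using (All)
import Data.List.Relation.Unary.All.Properties as AllP
open import Data.Nat as ℕ using (ℕ; zero; suc; _∸_; _≤_; _<_; z≤n; s≤s; _+_; pred)
import Data.Nat.Coprimality as Coprime
open import Data.Nat.ListAction using (sum)
import Data.Nat.Properties as NP
open import Data.Product using (_×_; _,_; proj₁; proj₂)
open import Data.Rational as ℚ using (ℚ; 0ℚ; 1ℚ; mkℚ)
import Data.Rational.Properties as QP
open import Data.Rational.Solver using (module +-*-Solver)
import Data.Sign as Sign
open import Function using (_∘_)
open import Relation.Binary.Bundles using (Setoid)
open import Relation.Binary.PropositionalEquality as Eq using (_≡_; _≢_; cong; cong₂; sym; subst)
import Relation.Binary.Reasoning.Setoid as SetoidReasoning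
open import Relation.Nullary using (yes; no; ¬_; Dec)

applyUpTo-cong : ∀ {A : Set} n {f g : ℕ → A} → (∀ i → i < n → f i ≡ g i) → applyUpTo f n ≡ applyUpTo g n
applyUpTo-cong zero eq = Eq.refl
applyUpTo-cong (suc n) eq = cong₂ _∷_ (eq 0 (s≤s z≤n)) (applyUpTo-cong n (λ i i<n → eq (suc i) (s≤s i<n)))

applyUpTo-shift₁ : ∀ {A : Set} n (g : ℕ → A) → g n ≡ g 0 → applyUpTo (λ j → g (suc j)) n ↭ applyUpTo g n
applyUpTo-shift₁ zero g eq = refl
applyUpTo-shift₁ (suc n) g eq = begin
  applyUpTo (λ j → g (suc j)) (suc n)        ≡⟨ LP.applyUpTo-∷ʳ (λ j → g (suc j)) n ⟨
  applyUpTo (λ j → g (suc j)) n L.∷ʳ g (suc n) ≡⟨ cong (applyUpTo (λ j → g (suc j)) n L.∷ʳ_) eq ⟩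
  applyUpTo (λ j → g (suc j)) n L.∷ʳ g 0      ↭⟨ PermP.∷↭∷ʳ (g 0) _ ⟨
  applyUpTo g (suc n)                        ∎
  where open PermutationReasoning

applyUpTo-+ : ∀ {A : Set} p q (f : ℕ → A) → applyUpTo f (p + q) ≡ applyUpTo f p ++ applyUpTo (λ i → f (p + i)) q
applyUpTo-+ zero q f = Eq.refl
applyUpTo-+ (suc p) q f = cong (f 0 ∷_) (applyUpTo-+ p q (f ∘ suc))

-- Finite indexed unions of multisets.  ⋃ n f = f 0 ++ ⋯ ++ f (n-1); a list of
-- words stands for the multiset of its entries, so identities are stated up to
-- permutation (_↭_): they are the usual manipulations of finite double sums.
module IndexedUnions {A : Set} where

  ⋃ : ℕ → (ℕ → List A) → List A
  ⋃ n f = concat (applyUpTo f n)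

  concat-↭ : {xss yss : List (List A)} → xss ↭ yss → concat xss ↭ concat yss
  concat-↭ refl = refl
  concat-↭ (prep xs p) = PermP.++⁺ˡ xs (concat-↭ p)
  concat-↭ {xs ∷ ys ∷ xss} {_ ∷ _ ∷ yss} (swap _ _ p) = begin
    xs ++ ys ++ concat xss   ↭⟨ PermP.shifts xs ys ⟩
    ys ++ xs ++ concat xss   ↭⟨ PermP.++⁺ˡ ys (PermP.++⁺ˡ xs (concat-↭ p)) ⟩
    ys ++ xs ++ concat yss   ∎
    where open PermutationReasoning
  concat-↭ (trans p q) = trans (concat-↭ p) (concat-↭ q)

  ⋃-cong : ∀ n {f g : ℕ → List A} → (∀ j → j < n → f j ↭ g j) → ⋃ n f ↭ ⋃ n g
  ⋃-cong zero eq = refl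
  ⋃-cong (suc n) eq = PermP.++⁺ (eq 0 (s≤s z≤n)) (⋃-cong n (λ j j<n → eq (suc j) (s≤s j<n)))

  ⋃-singletons : ∀ n (f : ℕ → A) → ⋃ n (λ j → [ f j ]) ≡ applyUpTo f n
  ⋃-singletons zero f = Eq.refl
  ⋃-singletons (suc n) f = cong (f 0 ∷_) (⋃-singletons n (λ j → f (suc j)))

  ⋃-empty : ∀ n → ⋃ n (λ _ → []) ≡ []
  ⋃-empty zero = Eq.refl
  ⋃-empty (suc n) = ⋃-empty n

  ⋃-snoc : ∀ n (f : ℕ → List A) → ⋃ (suc n) f ≡ ⋃ n f ++ f n
  ⋃-snoc n f = begin
    concat (applyUpTo f (suc n))         ≡⟨ cong concat (LP.applyUpTo-∷ʳ f n) ⟨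
    concat (applyUpTo f n ++ [ f n ])    ≡⟨ LP.concat-++ (applyUpTo f n) [ f n ] ⟨
    ⋃ n f ++ (f n ++ [])                 ≡⟨ cong (⋃ n f ++_) (LP.++-identityʳ (f n)) ⟩
    ⋃ n f ++ f n                         ∎
    where open Eq.≡-Reasoning

  ++-interchange : (a b c d : List A) → (a ++ b) ++ (c ++ d) ↭ (a ++ c) ++ (b ++ d)
  ++-interchange a b c d = begin
    (a ++ b) ++ (c ++ d)   ↭⟨ PermP.++-assoc a b _ ⟩
    a ++ (b ++ (c ++ d))   ↭⟨ PermP.++⁺ˡ a (PermP.shifts b c) ⟩
    a ++ (c ++ (b ++ d))   ↭⟨ PermP.++-assoc a c _ ⟨
    (a ++ c) ++ (b ++ d)   ∎
    where open PermutationReasoning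

  ⋃-++ : ∀ n (f g : ℕ → List A) → ⋃ n (λ j → f j ++ g j) ↭ ⋃ n f ++ ⋃ n g
  ⋃-++ zero f g = refl
  ⋃-++ (suc n) f g = trans (PermP.++⁺ˡ (f 0 ++ g 0) (⋃-++ n (f ∘ suc) (g ∘ suc)))
                           (++-interchange (f 0) (g 0) (⋃ n (f ∘ suc)) (⋃ n (g ∘ suc)))

  ⋃-swap : ∀ n K (X : ℕ → ℕ → List A) → ⋃ n (λ j → ⋃ K (X j)) ↭ ⋃ K (λ i → ⋃ n (λ j → X j i))
  ⋃-swap zero K X = ↭-reflexive (sym (⋃-empty K))
  ⋃-swap (suc n) K X = trans (PermP.++⁺ˡ (⋃ K (X 0)) (⋃-swap n K (λ j → X (suc j))))
    (↭-sym (⋃-++ K (X 0) (λ i → ⋃ n (λ j → X (suc j) i))))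

  ⋃-rotate : ∀ n (f : ℕ → List A) → (∀ m → f (m + n) ≡ f m) → ∀ s → ⋃ n (λ j → f (j + s)) ↭ ⋃ n f
  ⋃-rotate n f periodic zero = ↭-reflexive (cong concat (applyUpTo-cong n (λ i _ → cong f (NP.+-identityʳ i))))
  ⋃-rotate n f periodic (suc s) = begin
    ⋃ n (λ j → f (j + suc s))   ≡⟨ cong concat (applyUpTo-cong n (λ i _ → cong f (NP.+-suc i s))) ⟩
    ⋃ n (λ j → f (suc j + s))   ↭⟨ concat-↭ (applyUpTo-shift₁ n (λ j → f (j + s)) (Eq.trans (cong f (NP.+-comm n s)) (periodic s))) ⟩
    ⋃ n (λ j → f (j + s))       ↭⟨ ⋃-rotate n f periodic s ⟩
    ⋃ n f                       ∎
    where open PermutationReasoning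

  ⋃-reverse : ∀ n (f : ℕ → List A) → ⋃ n (λ i → f (n ∸ i)) ↭ ⋃ n (λ i → f (suc i))
  ⋃-reverse n f = trans (↭-reflexive (cong concat (reversed n)))
                        (concat-↭ (PermP.↭-reverse (applyUpTo (λ i → f (suc i)) n)))
    where
    reversed : ∀ n → applyUpTo (λ i → f (n ∸ i)) n ≡ reverse (applyUpTo (λ i → f (suc i)) n)
    reversed zero = Eq.refl
    reversed (suc n) = begin
      f (suc n) ∷ applyUpTo (λ i → f (n ∸ i)) n               ≡⟨ cong (f (suc n) ∷_) (reversed n) ⟩
      f (suc n) ∷ reverse (applyUpTo (λ i → f (suc i)) n)     ≡⟨ LP.reverse-++ (applyUpTo (λ i → f (suc i)) n) [ f (suc n) ] ⟨
      reverse (applyUpTo (λ i → f (suc i)) n L.∷ʳ f (suc n))  ≡⟨ cong reverse (LP.applyUpTo-∷ʳ (λ i → f (suc i)) n) ⟩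
      reverse (applyUpTo (λ i → f (suc i)) (suc n))           ∎
      where open Eq.≡-Reasoning

open IndexedUnions

ℕ→ℚ-suc : ∀ n → ℕ→ℚ (suc n) ≡ 1ℚ ℚ.+ ℕ→ℚ n
ℕ→ℚ-suc n = begin
  ℕ→ℚ (suc n)                   ≡⟨ QP./-cong {q₁ = 1} numerators Eq.refl ⟩
  1ℚ ℚ.+ mkℚ (pos n) 0 coprime  ≡⟨ cong (1ℚ ℚ.+_) (QP.normalize-coprime coprime) ⟨
  1ℚ ℚ.+ ℕ→ℚ n                  ∎
  where
  open Eq.≡-Reasoning
  coprime : Coprime.Coprime n 1
  coprime = Coprime.sym (Coprime.1-coprimeTo n)
  numerators : pos (suc n) ≡ pos 1 ℤ.+ (Sign.+ ℤ.◃ n ℕ.* 1)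
  numerators = Eq.trans (cong (pos ∘ suc) (sym (NP.*-identityʳ n)))
                        (cong (λ z → pos 1 ℤ.+ z) (sym (ℤP.+◃n≡+n (n ℕ.* 1))))

monoCoeff : ℚ → ℕ → Word → ℕ → Word → ℚ
monoCoeff c e v m u with e ℕ.≟ m | ≡-dec ℕ._≟_ v u
... | yes _ | yes _ = c
... | _     | _     = 0ℚ

coeff-∷ : ∀ c e v p m u → coeff (term c e v ∷ p) m u ≡ monoCoeff c e v m u ℚ.+ coeff p m u
coeff-∷ c e v p m u with e ℕ.≟ m | ≡-dec ℕ._≟_ v u
... | yes _ | yes _ = Eq.refl
... | yes _ | no _  = sym (QP.+-identityˡ _)
... | no _  | _     = sym (QP.+-identityˡ _)

Matches : ℕ → Word → ℕ → Word → Set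
Matches e v m u = e ≡ m × v ≡ u

matches? : ∀ e v m u → Dec (Matches e v m u)
matches? e v m u with e ℕ.≟ m | ≡-dec ℕ._≟_ v u
... | yes p | yes q = yes (p , q)
... | yes _ | no ¬q = no (¬q ∘ proj₂)
... | no ¬p | _     = no (¬p ∘ proj₁)

monoCoeff-match : ∀ c e v m u → Matches e v m u → monoCoeff c e v m u ≡ c
monoCoeff-match c e v m u (p , q) with e ℕ.≟ m | ≡-dec ℕ._≟_ v u
... | yes _ | yes _ = Eq.refl
... | yes _ | no ¬q = ⊥-elim (¬q q)
... | no ¬p | _     = ⊥-elim (¬p p)

monoCoeff-miss : ∀ c e v m u → ¬ Matches e v m u → monoCoeff c e v m u ≡ 0ℚ
monoCoeff-miss c e v m u miss with e ℕ.≟ m | ≡-dec ℕ._≟_ v u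
... | yes p | yes q = ⊥-elim (miss (p , q))
... | yes _ | no _  = Eq.refl
... | no _  | _     = Eq.refl

monoCoeff-transport : ∀ c e v m u e′ v′ m′ u′ →
  (Matches e v m u → Matches e′ v′ m′ u′) → (Matches e′ v′ m′ u′ → Matches e v m u) →
  monoCoeff c e v m u ≡ monoCoeff c e′ v′ m′ u′
monoCoeff-transport c e v m u e′ v′ m′ u′ to from with matches? e v m u
... | yes hit  = Eq.trans (monoCoeff-match c e v m u hit) (sym (monoCoeff-match c e′ v′ m′ u′ (to hit)))
... | no  miss = Eq.trans (monoCoeff-miss c e v m u miss) (sym (monoCoeff-miss c e′ v′ m′ u′ (miss ∘ from)))

monoCoeff-* : ∀ a c e v m u → monoCoeff (a ℚ.* c) e v m u ≡ a ℚ.* monoCoeff c e v m u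
monoCoeff-* a c e v m u with matches? e v m u
... | yes hit  = Eq.trans (monoCoeff-match _ e v m u hit) (cong (a ℚ.*_) (sym (monoCoeff-match c e v m u hit)))
... | no  miss = Eq.trans (monoCoeff-miss _ e v m u miss)
                   (Eq.trans (sym (QP.*-zeroʳ a)) (cong (a ℚ.*_) (sym (monoCoeff-miss c e v m u miss))))

monoCoeff-zero : ∀ e v m u → monoCoeff 0ℚ e v m u ≡ 0ℚ
monoCoeff-zero e v m u with matches? e v m u
... | yes hit  = monoCoeff-match 0ℚ e v m u hit
... | no  miss = monoCoeff-miss 0ℚ e v m u miss

-- _≈_ is a function type from which Agda cannot recover the two polynomials;
-- packing it in a record makes the polynomials inferable in equational proofs.
infix 4 _≋_
record _≋_ (p q : Poly) : Set where
  constructor coeffwise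
  field coeffs : p ≈ q
open _≋_

≋-setoid : Setoid _ _
≋-setoid = record
  { Carrier = Poly
  ; _≈_ = _≋_
  ; isEquivalence = record
    { refl  = coeffwise λ m u → Eq.refl
    ; sym   = λ (coeffwise e) → coeffwise λ m u → sym (e m u)
    ; trans = λ (coeffwise e) (coeffwise f) → coeffwise λ m u → Eq.trans (e m u) (f m u)
    }
  }

open Setoid ≋-setoid using () renaming (refl to ≋-refl; trans to ≋-trans; reflexive to ≡⇒≋)

coeff-++ : ∀ p q m u → coeff (p ++ q) m u ≡ coeff p m u ℚ.+ coeff q m u
coeff-++ [] q m u = sym (QP.+-identityˡ _)
coeff-++ (term c e v ∷ p) q m u = begin
  coeff (term c e v ∷ (p ++ q)) m u                ≡⟨ coeff-∷ c e v (p ++ q) m u ⟩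
  μ ℚ.+ coeff (p ++ q) m u                         ≡⟨ cong (μ ℚ.+_) (coeff-++ p q m u) ⟩
  μ ℚ.+ (coeff p m u ℚ.+ coeff q m u)              ≡⟨ QP.+-assoc μ _ _ ⟨
  (μ ℚ.+ coeff p m u) ℚ.+ coeff q m u              ≡⟨ cong (ℚ._+ coeff q m u) (coeff-∷ c e v p m u) ⟨
  coeff (term c e v ∷ p) m u ℚ.+ coeff q m u       ∎
  where
  open Eq.≡-Reasoning
  μ : ℚ
  μ = monoCoeff c e v m u

++-cong : ∀ {p p′ q q′} → p ≋ p′ → q ≋ q′ → p ++ q ≋ p′ ++ q′
++-cong {p} {p′} {q} {q′} (coeffwise e) (coeffwise f) = coeffwise λ m u →
  Eq.trans (coeff-++ p q m u) (Eq.trans (cong₂ ℚ._+_ (e m u) (f m u)) (sym (coeff-++ p′ q′ m u)))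

↭⇒≋ : ∀ {p q} → p ↭ q → p ≋ q
↭⇒≋ {p} refl = ≋-refl {p}
↭⇒≋ (prep {xs} {ys} x p) = ++-cong {[ x ]} {[ x ]} {xs} {ys} (≋-refl {[ x ]}) (↭⇒≋ p)
↭⇒≋ (swap {xs} {ys} x y p) = ≋-trans {x ∷ y ∷ xs} {y ∷ x ∷ xs} {y ∷ x ∷ ys}
  (coeffwise λ m u → begin
    coeff ([ x ] ++ [ y ] ++ xs) m u               ≡⟨ coeff-++ [ x ] _ m u ⟩
    cx m u ℚ.+ coeff ([ y ] ++ xs) m u             ≡⟨ cong (cx m u ℚ.+_) (coeff-++ [ y ] xs m u) ⟩
    cx m u ℚ.+ (cy m u ℚ.+ coeff xs m u)           ≡⟨ QP.+-assoc (cx m u) _ _ ⟨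
    (cx m u ℚ.+ cy m u) ℚ.+ coeff xs m u           ≡⟨ cong (ℚ._+ coeff xs m u) (QP.+-comm (cx m u) _) ⟩
    (cy m u ℚ.+ cx m u) ℚ.+ coeff xs m u           ≡⟨ QP.+-assoc (cy m u) _ _ ⟩
    cy m u ℚ.+ (cx m u ℚ.+ coeff xs m u)           ≡⟨ cong (cy m u ℚ.+_) (coeff-++ [ x ] xs m u) ⟨
    cy m u ℚ.+ coeff ([ x ] ++ xs) m u             ≡⟨ coeff-++ [ y ] _ m u ⟨
    coeff ([ y ] ++ [ x ] ++ xs) m u               ∎)
  (++-cong {y ∷ x ∷ []} {y ∷ x ∷ []} {xs} {ys} (≋-refl {y ∷ x ∷ []}) (↭⇒≋ p))
  where
  open Eq.≡-Reasoning
  cx cy : ℕ → Word → ℚ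
  cx = coeff [ x ]
  cy = coeff [ y ]
↭⇒≋ (trans {xs} {ys} {zs} p q) = ≋-trans {xs} {ys} {zs} (↭⇒≋ p) (↭⇒≋ q)

coeff-map : ∀ (f : Term → Term) (φ : ℚ → ℚ) {m u m′ u′} →
  (∀ x y → φ (x ℚ.+ y) ≡ φ x ℚ.+ φ y) → φ 0ℚ ≡ 0ℚ →
  (∀ c e v → coeff [ f (term c e v) ] m u ≡ φ (monoCoeff c e v m′ u′)) →
  ∀ p → coeff (map f p) m u ≡ φ (coeff p m′ u′)
coeff-map f φ additive zero-fixed single [] = sym zero-fixed
coeff-map f φ {m} {u} {m′} {u′} additive zero-fixed single (term c e v ∷ p) = begin
  coeff ([ f (term c e v) ] ++ map f p) m u                     ≡⟨ coeff-++ [ f (term c e v) ] (map f p) m u ⟩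
  coeff [ f (term c e v) ] m u ℚ.+ coeff (map f p) m u          ≡⟨ cong₂ ℚ._+_ (single c e v) (coeff-map f φ additive zero-fixed single p) ⟩
  φ (monoCoeff c e v m′ u′) ℚ.+ φ (coeff p m′ u′)               ≡⟨ additive _ _ ⟨
  φ (monoCoeff c e v m′ u′ ℚ.+ coeff p m′ u′)                   ≡⟨ cong φ (coeff-∷ c e v p m′ u′) ⟨
  φ (coeff (term c e v ∷ p) m′ u′)                              ∎
  where open Eq.≡-Reasoning

coeff-single : ∀ c e v m u → coeff [ term c e v ] m u ≡ monoCoeff c e v m u
coeff-single c e v m u = Eq.trans (coeff-∷ c e v [] m u) (QP.+-identityʳ _)

coeff-map-miss : ∀ (f : Term → Term) {m u} → (∀ c e v → coeff [ f (term c e v) ] m u ≡ 0ℚ) →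
  ∀ p → coeff (map f p) m u ≡ 0ℚ
coeff-map-miss f {m} {u} single = coeff-map f (λ _ → 0ℚ) {m′ = m} {u′ = u} (λ _ _ → Eq.refl) Eq.refl single

coeff-scale : ∀ a p m u → coeff (scale a 0 p) m u ≡ a ℚ.* coeff p m u
coeff-scale a p m u = coeff-map _ (a ℚ.*_) (QP.*-distribˡ-+ a) (QP.*-zeroʳ a)
  (λ c e v → Eq.trans (coeff-single (a ℚ.* c) e v m u) (monoCoeff-* a c e v m u)) p

coeff-t·-suc : ∀ a p m u → coeff (scale a 1 p) (suc m) u ≡ a ℚ.* coeff p m u
coeff-t·-suc a p m u = coeff-map _ (a ℚ.*_) (QP.*-distribˡ-+ a) (QP.*-zeroʳ a)
  (λ c e v → Eq.trans (coeff-single (a ℚ.* c) (suc e) v (suc m) u)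
    (Eq.trans (monoCoeff-* a c (suc e) v (suc m) u)
      (cong (a ℚ.*_) (monoCoeff-transport c (suc e) v (suc m) u e v m u
        (λ (p , q) → NP.suc-injective p , q) (λ (p , q) → cong suc p , q))))) p

coeff-t·-zero : ∀ a p u → coeff (scale a 1 p) 0 u ≡ 0ℚ
coeff-t·-zero a p u = coeff-map-miss _
  (λ c e v → Eq.trans (coeff-single (a ℚ.* c) (suc e) v 0 u) (monoCoeff-miss (a ℚ.* c) (suc e) v 0 u λ ()))
  p

coeff-ddt : ∀ p m u → coeff (ddt p) m u ≡ coeff p (suc m) u ℚ.* ℕ→ℚ (suc m)
coeff-ddt p m u = coeff-map _ (ℚ._* n) (λ x y → QP.*-distribʳ-+ n x y) (QP.*-zeroˡ n)
  (λ c e v → Eq.trans (coeff-single (c ℚ.* ℕ→ℚ e) (e ∸ 1) v m u) (derivative c e v)) p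
  where
  n : ℚ
  n = ℕ→ℚ (suc m)
  derivative : ∀ c e v → monoCoeff (c ℚ.* ℕ→ℚ e) (e ∸ 1) v m u ≡ monoCoeff c e v (suc m) u ℚ.* ℕ→ℚ (suc m)
  derivative c zero v = begin
    monoCoeff (c ℚ.* 0ℚ) 0 v m u               ≡⟨ cong (λ z → monoCoeff z 0 v m u) (QP.*-zeroʳ c) ⟩
    monoCoeff 0ℚ 0 v m u                       ≡⟨ monoCoeff-zero 0 v m u ⟩
    0ℚ                                         ≡⟨ QP.*-zeroˡ n ⟨
    0ℚ ℚ.* ℕ→ℚ (suc m)                         ≡⟨ cong (ℚ._* ℕ→ℚ (suc m)) (monoCoeff-miss c 0 v (suc m) u λ ()) ⟨
    monoCoeff c 0 v (suc m) u ℚ.* ℕ→ℚ (suc m)  ∎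
    where open Eq.≡-Reasoning
  derivative c (suc e) v with matches? e v m u
  ... | yes (Eq.refl , q) = Eq.trans (monoCoeff-match (c ℚ.* ℕ→ℚ (suc e)) e v e u (Eq.refl , q))
                              (cong (ℚ._* ℕ→ℚ (suc e)) (sym (monoCoeff-match c (suc e) v (suc e) u (Eq.refl , q))))
  ... | no miss = Eq.trans (monoCoeff-miss (c ℚ.* ℕ→ℚ (suc e)) e v m u miss)
                    (sym (Eq.trans (cong (ℚ._* ℕ→ℚ (suc m)) (monoCoeff-miss c (suc e) v (suc m) u
                                      λ (p , q) → miss (NP.suc-injective p , q)))
                                   (QP.*-zeroˡ n)))

coeff-zmul-head : ∀ k p m u → coeff (zmul k p) m (k ∷ u) ≡ coeff p m u
coeff-zmul-head k p m u = coeff-map _ (λ x → x) (λ _ _ → Eq.refl) Eq.refl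
  (λ c e v → Eq.trans (coeff-single c e (k ∷ v) m (k ∷ u))
    (monoCoeff-transport c e (k ∷ v) m (k ∷ u) e v m u
      (λ (p , q) → p , LP.∷-injectiveʳ q) (λ (p , q) → p , cong (k ∷_) q))) p

coeff-zmul-miss : ∀ k p m u → (∀ v → u ≢ k ∷ v) → coeff (zmul k p) m u ≡ 0ℚ
coeff-zmul-miss k p m u headless = coeff-map-miss _
  (λ c e v → Eq.trans (coeff-single c e (k ∷ v) m u)
    (monoCoeff-miss c e (k ∷ v) m u λ (_ , q) → headless v (sym q))) p

zmul-cong : ∀ k {p q} → p ≋ q → zmul k p ≋ zmul k q
zmul-cong k {p} {q} (coeffwise eq) = coeffwise coeffs′
  where
  coeffs′ : zmul k p ≈ zmul k q
  coeffs′ m (a ∷ u) with a ℕ.≟ k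
  ... | yes Eq.refl = Eq.trans (coeff-zmul-head k p m u) (Eq.trans (eq m u) (sym (coeff-zmul-head k q m u)))
  ... | no a≢k = Eq.trans (coeff-zmul-miss k p m (a ∷ u) headless) (sym (coeff-zmul-miss k q m (a ∷ u) headless))
    where
    headless : ∀ v → a ∷ u ≢ k ∷ v
    headless v = a≢k ∘ LP.∷-injectiveˡ
  coeffs′ m [] = Eq.trans (coeff-zmul-miss k p m [] (λ _ ())) (sym (coeff-zmul-miss k q m [] (λ _ ())))

coeff-circ-head : ∀ k p m l u → coeff (circ k p) m (k + l ∷ u) ≡ coeff p m (l ∷ u)
coeff-circ-head k [] m l u = Eq.refl
coeff-circ-head k (term c e [] ∷ p) m l u = begin
  coeff (circ k p) m (k + l ∷ u)                              ≡⟨ coeff-circ-head k p m l u ⟩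
  coeff p m (l ∷ u)                                           ≡⟨ QP.+-identityˡ _ ⟨
  0ℚ ℚ.+ coeff p m (l ∷ u)                                    ≡⟨ cong (ℚ._+ coeff p m (l ∷ u)) (monoCoeff-miss c e [] m (l ∷ u) λ ()) ⟨
  monoCoeff c e [] m (l ∷ u) ℚ.+ coeff p m (l ∷ u)            ≡⟨ coeff-∷ c e [] p m (l ∷ u) ⟨
  coeff (term c e [] ∷ p) m (l ∷ u)                           ∎
  where open Eq.≡-Reasoning
coeff-circ-head k (term c e (l′ ∷ v) ∷ p) m l u = begin
  coeff (term c e (k + l′ ∷ v) ∷ circ k p) m (k + l ∷ u)                  ≡⟨ coeff-∷ c e (k + l′ ∷ v) (circ k p) m (k + l ∷ u) ⟩
  monoCoeff c e (k + l′ ∷ v) m (k + l ∷ u) ℚ.+ coeff (circ k p) m (k + l ∷ u)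
     ≡⟨ cong₂ ℚ._+_ (monoCoeff-transport c e (k + l′ ∷ v) m (k + l ∷ u) e (l′ ∷ v) m (l ∷ u) cancel extend)
                    (coeff-circ-head k p m l u) ⟩
  monoCoeff c e (l′ ∷ v) m (l ∷ u) ℚ.+ coeff p m (l ∷ u)                 ≡⟨ coeff-∷ c e (l′ ∷ v) p m (l ∷ u) ⟨
  coeff (term c e (l′ ∷ v) ∷ p) m (l ∷ u)                                ∎
  where
  open Eq.≡-Reasoning
  cancel : Matches e (k + l′ ∷ v) m (k + l ∷ u) → Matches e (l′ ∷ v) m (l ∷ u)
  cancel (p , q) = p , cong₂ _∷_ (NP.+-cancelˡ-≡ k l′ l (LP.∷-injectiveˡ q)) (LP.∷-injectiveʳ q)
  extend : Matches e (l′ ∷ v) m (l ∷ u) → Matches e (k + l′ ∷ v) m (k + l ∷ u)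
  extend (p , q) = p , cong₂ _∷_ (cong (k +_) (LP.∷-injectiveˡ q)) (LP.∷-injectiveʳ q)

coeff-circ-miss : ∀ k p m u → (∀ l v → u ≢ k + l ∷ v) → coeff (circ k p) m u ≡ 0ℚ
coeff-circ-miss k [] m u headless = Eq.refl
coeff-circ-miss k (term c e [] ∷ p) m u headless = coeff-circ-miss k p m u headless
coeff-circ-miss k (term c e (l ∷ v) ∷ p) m u headless =
  Eq.trans (coeff-∷ c e (k + l ∷ v) (circ k p) m u)
    (cong₂ ℚ._+_ (monoCoeff-miss c e (k + l ∷ v) m u λ (_ , q) → headless l v (sym q))
                 (coeff-circ-miss k p m u headless))

circ-cong : ∀ k {p q} → p ≋ q → circ k p ≋ circ k q
circ-cong k {p} {q} (coeffwise eq) = coeffwise coeffs′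
  where
  coeffs′ : circ k p ≈ circ k q
  coeffs′ m (a ∷ u) with k ℕ.≤? a
  ... | yes k≤a = subst (λ b → coeff (circ k p) m (b ∷ u) ≡ coeff (circ k q) m (b ∷ u)) (NP.m+[n∸m]≡n k≤a)
        (Eq.trans (coeff-circ-head k p m (a ∸ k) u) (Eq.trans (eq m (a ∸ k ∷ u)) (sym (coeff-circ-head k q m (a ∸ k) u))))
  ... | no k≰a = Eq.trans (coeff-circ-miss k p m (a ∷ u) headless) (sym (coeff-circ-miss k q m (a ∷ u) headless))
    where
    headless : ∀ l v → a ∷ u ≢ k + l ∷ v
    headless l v eq = k≰a (subst (k ≤_) (sym (LP.∷-injectiveˡ eq)) (NP.m≤m+n k l))
  coeffs′ m [] = Eq.trans (coeff-circ-miss k p m [] (λ _ _ ())) (sym (coeff-circ-miss k q m [] (λ _ _ ())))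

t·-cong : ∀ a {p q} → p ≋ q → scale a 1 p ≋ scale a 1 q
t·-cong a {p} {q} (coeffwise eq) = coeffwise coeffs′
  where
  coeffs′ : scale a 1 p ≈ scale a 1 q
  coeffs′ zero u = Eq.trans (coeff-t·-zero a p u) (sym (coeff-t·-zero a q u))
  coeffs′ (suc m) u = Eq.trans (coeff-t·-suc a p m u) (Eq.trans (cong (a ℚ.*_) (eq m u)) (sym (coeff-t·-suc a q m u)))

t·_ : Poly → Poly
t· p = scale 1ℚ 1 p

ddt-zmul : ∀ k p → ddt (zmul k p) ≡ zmul k (ddt p)
ddt-zmul k [] = Eq.refl
ddt-zmul k (term c e v ∷ p) = cong (_ ∷_) (ddt-zmul k p)

circ-ddt : ∀ k p → circ k (ddt p) ≡ ddt (circ k p)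
circ-ddt k [] = Eq.refl
circ-ddt k (term c e [] ∷ p) = circ-ddt k p
circ-ddt k (term c e (l ∷ v) ∷ p) = cong (_ ∷_) (circ-ddt k p)

circ-++ : ∀ k p q → circ k (p ++ q) ≡ circ k p ++ circ k q
circ-++ k [] q = Eq.refl
circ-++ k (term c e [] ∷ p) q = circ-++ k p q
circ-++ k (term c e (l ∷ v) ∷ p) q = cong (_ ∷_) (circ-++ k p q)

circ-zmul : ∀ k h p → circ k (zmul h p) ≡ zmul (k + h) p
circ-zmul k h [] = Eq.refl
circ-zmul k h (term c e v ∷ p) = cong (_ ∷_) (circ-zmul k h p)

circ-t· : ∀ k p → circ k (t· p) ≡ t· circ k p
circ-t· k [] = Eq.refl
circ-t· k (term c e [] ∷ p) = circ-t· k p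
circ-t· k (term c e (l ∷ v) ∷ p) = cong (_ ∷_) (circ-t· k p)

circ-circ : ∀ k h p → circ k (circ h p) ≡ circ (k + h) p
circ-circ k h [] = Eq.refl
circ-circ k h (term c e [] ∷ p) = circ-circ k h p
circ-circ k h (term c e (l ∷ v) ∷ p) =
  cong₂ _∷_ (cong (λ z → term c e (z ∷ v)) (sym (NP.+-assoc k h l))) (circ-circ k h p)

ddt-leibniz : ∀ A X → ddt (A ++ t· X) ≋ X ++ (ddt A ++ t· ddt X)
ddt-leibniz A X = coeffwise coeffs′
  where
  open +-*-Solver
  coeff-rhs : ∀ m u → coeff (X ++ (ddt A ++ t· ddt X)) m u
                    ≡ coeff X m u ℚ.+ (coeff (ddt A) m u ℚ.+ coeff (t· ddt X) m u)
  coeff-rhs m u = Eq.trans (coeff-++ X _ m u) (cong (coeff X m u ℚ.+_) (coeff-++ (ddt A) _ m u))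
  coeff-lhs : ∀ m u → coeff (ddt (A ++ t· X)) m u ≡ (coeff A (suc m) u ℚ.+ 1ℚ ℚ.* coeff X m u) ℚ.* ℕ→ℚ (suc m)
  coeff-lhs m u = Eq.trans (coeff-ddt (A ++ t· X) m u)
    (cong (ℚ._* ℕ→ℚ (suc m)) (Eq.trans (coeff-++ A _ (suc m) u) (cong (coeff A (suc m) u ℚ.+_) (coeff-t·-suc 1ℚ X m u))))
  coeffs′ : ddt (A ++ t· X) ≈ X ++ (ddt A ++ t· ddt X)
  coeffs′ zero u = begin
    coeff (ddt (A ++ t· X)) 0 u              ≡⟨ coeff-lhs 0 u ⟩
    (a ℚ.+ 1ℚ ℚ.* x) ℚ.* 1ℚ                  ≡⟨ solve 2 (λ a x → (a :+ con 1ℚ :* x) :* con 1ℚ := x :+ (a :* con 1ℚ :+ con 0ℚ)) Eq.refl a x ⟩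
    x ℚ.+ (a ℚ.* 1ℚ ℚ.+ 0ℚ)                  ≡⟨ cong (x ℚ.+_) (cong₂ ℚ._+_ (coeff-ddt A 0 u) (coeff-t·-zero 1ℚ (ddt X) u)) ⟨
    x ℚ.+ (coeff (ddt A) 0 u ℚ.+ coeff (t· ddt X) 0 u)   ≡⟨ coeff-rhs 0 u ⟨
    coeff (X ++ (ddt A ++ t· ddt X)) 0 u     ∎
    where
    open Eq.≡-Reasoning
    a x : ℚ
    a = coeff A 1 u
    x = coeff X 0 u
  coeffs′ (suc m) u = begin
    coeff (ddt (A ++ t· X)) (suc m) u        ≡⟨ coeff-lhs (suc m) u ⟩
    (a ℚ.+ 1ℚ ℚ.* x) ℚ.* ℕ→ℚ (suc (suc m))   ≡⟨ cong ((a ℚ.+ 1ℚ ℚ.* x) ℚ.*_) (ℕ→ℚ-suc (suc m)) ⟩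
    (a ℚ.+ 1ℚ ℚ.* x) ℚ.* (1ℚ ℚ.+ n)          ≡⟨ solve 3 (λ a x n → (a :+ con 1ℚ :* x) :* (con 1ℚ :+ n)
                                                       := x :+ (a :* (con 1ℚ :+ n) :+ con 1ℚ :* (x :* n))) Eq.refl a x n ⟩
    x ℚ.+ (a ℚ.* (1ℚ ℚ.+ n) ℚ.+ 1ℚ ℚ.* (x ℚ.* n))
       ≡⟨ cong (λ z → x ℚ.+ (a ℚ.* z ℚ.+ 1ℚ ℚ.* (x ℚ.* n))) (ℕ→ℚ-suc (suc m)) ⟨
    x ℚ.+ (a ℚ.* ℕ→ℚ (suc (suc m)) ℚ.+ 1ℚ ℚ.* (x ℚ.* n))
       ≡⟨ cong (x ℚ.+_) (cong₂ ℚ._+_ (coeff-ddt A (suc m) u)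
                                    (Eq.trans (coeff-t·-suc 1ℚ (ddt X) m u) (cong (1ℚ ℚ.*_) (coeff-ddt X m u)))) ⟨
    x ℚ.+ (coeff (ddt A) (suc m) u ℚ.+ coeff (t· ddt X) (suc m) u)   ≡⟨ coeff-rhs (suc m) u ⟨
    coeff (X ++ (ddt A ++ t· ddt X)) (suc m) u   ∎
    where
    open Eq.≡-Reasoning
    a x n : ℚ
    a = coeff A (suc (suc m)) u
    x = coeff X (suc m) u
    n = ℕ→ℚ (suc m)

mergeAt : ℕ → Word → Word
mergeAt zero (a ∷ b ∷ r) = (a + b) ∷ r
mergeAt zero r = r
mergeAt (suc i) [] = []
mergeAt (suc i) (a ∷ r) = a ∷ mergeAt i r

merges : Word → List Word
merges v = applyUpTo (λ i → mergeAt i v) (pred (length v))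

merges-∷ : ∀ k h v → merges (k ∷ h ∷ v) ≡ ((k + h) ∷ v) ∷ map (k ∷_) (merges (h ∷ v))
merges-∷ k h v = cong (((k + h) ∷ v) ∷_) (sym (LP.map-applyUpTo (λ i → mergeAt i (h ∷ v)) (k ∷_) (length v)))

Stˡ : List Word → Poly
Stˡ = concatMap Stw

Stˡ-∷ : ∀ k L → Stˡ (map (k ∷_) L) ↭ zmul k (Stˡ L) ++ t· circ k (Stˡ L)
Stˡ-∷ k [] = refl
Stˡ-∷ k (v ∷ L) = begin
  (zmul k (Stw v) ++ t· circ k (Stw v)) ++ Stˡ (map (k ∷_) L)
     ↭⟨ PermP.++⁺ˡ (zmul k (Stw v) ++ t· circ k (Stw v)) (Stˡ-∷ k L) ⟩
  (zmul k (Stw v) ++ t· circ k (Stw v)) ++ (zmul k (Stˡ L) ++ t· circ k (Stˡ L))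
     ↭⟨ ++-interchange (zmul k (Stw v)) (t· circ k (Stw v)) (zmul k (Stˡ L)) (t· circ k (Stˡ L)) ⟩
  (zmul k (Stw v) ++ zmul k (Stˡ L)) ++ (t· circ k (Stw v) ++ t· circ k (Stˡ L))
     ≡⟨ cong₂ _++_ (LP.map-++ _ (Stw v) (Stˡ L))
                   (Eq.trans (cong t·_ (circ-++ k (Stw v) (Stˡ L))) (LP.map-++ _ (circ k (Stw v)) _)) ⟨
  zmul k (Stw v ++ Stˡ L) ++ t· circ k (Stw v ++ Stˡ L)   ∎
  where open PermutationReasoning

circ-Stw : ∀ k h v → circ k (Stw (h ∷ v)) ≡ Stw ((k + h) ∷ v)
circ-Stw k h v = begin
  circ k (zmul h (Stw v) ++ t· circ h (Stw v))          ≡⟨ circ-++ k (zmul h (Stw v)) _ ⟩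
  circ k (zmul h (Stw v)) ++ circ k (t· circ h (Stw v)) ≡⟨ cong₂ _++_ (circ-zmul k h (Stw v)) (circ-t· k (circ h (Stw v))) ⟩
  zmul (k + h) (Stw v) ++ t· circ k (circ h (Stw v))    ≡⟨ cong (λ p → zmul (k + h) (Stw v) ++ t· p) (circ-circ k h (Stw v)) ⟩
  zmul (k + h) (Stw v) ++ t· circ (k + h) (Stw v)       ∎
  where open Eq.≡-Reasoning

-- Induction on v: by Leibniz, d/dt S^t(z_k v) = z_k ∘ S^t(v) + z_k·d/dt S^t(v)
-- + t z_k ∘ d/dt S^t(v); the first term is the merge at position 0, the other two
-- assemble (by the recursion of S^t) into S^t of the merges inside v.
ddt-Stw : ∀ v → ddt (Stw v) ≋ Stˡ (merges v)
ddt-Stw [] = coeffwise λ m u → Eq.trans (coeff-single (1ℚ ℚ.* 0ℚ) 0 [] m u) (monoCoeff-zero 0 [] m u)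
ddt-Stw (k ∷ v) = begin
  ddt (zmul k (Stw v) ++ t· circ k (Stw v))
     ≈⟨ ddt-leibniz (zmul k (Stw v)) (circ k (Stw v)) ⟩
  circ k (Stw v) ++ (ddt (zmul k (Stw v)) ++ t· ddt (circ k (Stw v)))
     ≈⟨ ++-cong (≋-refl {circ k (Stw v)}) (++-cong
          (≋-trans (≡⇒≋ (ddt-zmul k (Stw v))) (zmul-cong k (ddt-Stw v)))
          (t·-cong 1ℚ (≋-trans (≡⇒≋ (sym (circ-ddt k (Stw v)))) (circ-cong k (ddt-Stw v))))) ⟩
  circ k (Stw v) ++ (zmul k (Stˡ (merges v)) ++ t· circ k (Stˡ (merges v)))
     ≈⟨ first-merge v ⟩
  Stˡ (merges (k ∷ v))   ∎
  where
  open SetoidReasoning ≋-setoid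
  first-merge : ∀ v → circ k (Stw v) ++ (zmul k (Stˡ (merges v)) ++ t· circ k (Stˡ (merges v))) ≋ Stˡ (merges (k ∷ v))
  first-merge [] = ≋-refl {[]}
  first-merge (h ∷ v) = ≋-trans
    {circ k (Stw (h ∷ v)) ++ (zmul k (Stˡ (merges (h ∷ v))) ++ t· circ k (Stˡ (merges (h ∷ v))))}
    (↭⇒≋ (PermP.++⁺ (↭-reflexive (circ-Stw k h v)) (↭-sym (Stˡ-∷ k (merges (h ∷ v))))))
    (≡⇒≋ (cong Stˡ (sym (merges-∷ k h v))))

ddt-Stˡ : ∀ L → ddt (Stˡ L) ≋ Stˡ (concatMap merges L)
ddt-Stˡ [] = ≋-refl {[]}
ddt-Stˡ (v ∷ L) = begin
  ddt (Stw v ++ Stˡ L)                       ≡⟨ LP.map-++ _ (Stw v) (Stˡ L) ⟩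
  ddt (Stw v) ++ ddt (Stˡ L)                 ≈⟨ ++-cong (ddt-Stw v) (ddt-Stˡ L) ⟩
  Stˡ (merges v) ++ Stˡ (concatMap merges L) ≡⟨ LP.concatMap-++ Stw (merges v) (concatMap merges L) ⟨
  Stˡ (merges v ++ concatMap merges L)       ∎
  where open SetoidReasoning ≋-setoid

rot₁ : Word → Word
rot₁ [] = []
rot₁ (a ∷ r) = r ++ [ a ]

rotate : ℕ → Word → Word
rotate zero w = w
rotate (suc l) w = rotate l (rot₁ w)

length-rot₁ : ∀ w → length (rot₁ w) ≡ length w
length-rot₁ [] = Eq.refl
length-rot₁ (a ∷ r) = Eq.trans (LP.length-++ r) (NP.+-comm (length r) 1)

length-rotate : ∀ l w → length (rotate l w) ≡ length w
length-rotate zero w = Eq.refl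
length-rotate (suc l) w = Eq.trans (length-rotate l (rot₁ w)) (length-rot₁ w)

rotate-+ : ∀ a b w → rotate (a + b) w ≡ rotate b (rotate a w)
rotate-+ zero b w = Eq.refl
rotate-+ (suc a) b w = rotate-+ a b (rot₁ w)

rotate-suc : ∀ m w → rotate (suc m) w ≡ rot₁ (rotate m w)
rotate-suc m w = Eq.trans (cong (λ l → rotate l w) (NP.+-comm 1 m)) (rotate-+ m 1 w)

rotate-++ : ∀ x y → rotate (length x) (x ++ y) ≡ y ++ x
rotate-++ [] y = sym (LP.++-identityʳ y)
rotate-++ (a ∷ x) y = begin
  rotate (length x) ((x ++ y) ++ [ a ])   ≡⟨ cong (rotate (length x)) (LP.++-assoc x y [ a ]) ⟩
  rotate (length x) (x ++ y ++ [ a ])     ≡⟨ rotate-++ x (y ++ [ a ]) ⟩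
  (y ++ [ a ]) ++ x                       ≡⟨ LP.++-assoc y [ a ] x ⟩
  y ++ a ∷ x                              ∎
  where open Eq.≡-Reasoning

rotate-period : ∀ n w → length w ≡ n → rotate n w ≡ w
rotate-period _ w Eq.refl = Eq.trans (cong (rotate (length w)) (sym (LP.++-identityʳ w))) (rotate-++ w [])

All-rotate : ∀ {P : ℕ → Set} l w → All P w → All P (rotate l w)
All-rotate zero w pw = pw
All-rotate (suc l) [] pw = All-rotate l [] pw
All-rotate (suc l) (a ∷ r) (pa All.∷ pr) = All-rotate l (r ++ [ a ]) (AllP.++⁺ pr (pa All.∷ All.[]))

rot≡rotate : ∀ l w → l ≤ length w → rot l w ≡ rotate l w
rot≡rotate zero w _ = LP.++-identityʳ w
rot≡rotate (suc l) (a ∷ r) (s≤s l≤r) = begin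
  drop l r ++ a ∷ take l r                    ≡⟨ LP.++-assoc (drop l r) [ a ] (take l r) ⟨
  (drop l r ++ [ a ]) ++ take l r             ≡⟨ cong₂ _++_ (drop-++ l r l≤r) (take-++ l r l≤r) ⟨
  drop l (r ++ [ a ]) ++ take l (r ++ [ a ])  ≡⟨ rot≡rotate l (r ++ [ a ]) (NP.≤-trans l≤r (LP.length-++-≤ˡ r)) ⟩
  rotate l (r ++ [ a ])                       ∎
  where
  open Eq.≡-Reasoning
  drop-++ : ∀ l (r : Word) → l ≤ length r → drop l (r ++ [ a ]) ≡ drop l r ++ [ a ]
  drop-++ zero r _ = Eq.refl
  drop-++ (suc l) (b ∷ r) (s≤s l≤r) = drop-++ l r l≤r
  take-++ : ∀ l (r : Word) → l ≤ length r → take l (r ++ [ a ]) ≡ take l r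
  take-++ zero r _ = Eq.refl
  take-++ (suc l) (b ∷ r) (s≤s l≤r) = cong (b ∷_) (take-++ l r l≤r)

mergeAt-++ : ∀ i (r s : Word) → suc (suc i) ≤ length r → mergeAt i (r ++ s) ≡ mergeAt i r ++ s
mergeAt-++ zero (a ∷ b ∷ r) s _ = Eq.refl
mergeAt-++ zero (a ∷ []) s (s≤s ())
mergeAt-++ (suc i) (a ∷ r) s (s≤s le) = cong (a ∷_) (mergeAt-++ i r s le)

mergeAt-last : ∀ (r : Word) x y z → mergeAt (length r) (r ++ x ∷ y ∷ z) ≡ r ++ (x + y) ∷ z
mergeAt-last [] x y z = Eq.refl
mergeAt-last (a ∷ r) x y z = cong (a ∷_) (mergeAt-last r x y z)

length-mergeAt : ∀ i R n → length R ≡ suc (suc n) → i ≤ n → length (mergeAt i R) ≡ suc n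
length-mergeAt zero (a ∷ b ∷ r) n eq _ = NP.suc-injective eq
length-mergeAt (suc i) (a ∷ r) (suc n) eq (s≤s le) = cong suc (length-mergeAt i r n (NP.suc-injective eq) le)

rotate-mergeAt : ∀ i R → suc (suc i) ≤ length R → rotate i (mergeAt i R) ≡ mergeAt 0 (rotate i R)
rotate-mergeAt zero R le = Eq.refl
rotate-mergeAt (suc i) (a ∷ r) (s≤s le) = begin
  rotate i (mergeAt i r ++ [ a ])   ≡⟨ cong (rotate i) (mergeAt-++ i r [ a ] le) ⟨
  rotate i (mergeAt i (r ++ [ a ])) ≡⟨ rotate-mergeAt i (r ++ [ a ]) (NP.≤-trans (NP.n≤1+n _) (subst (suc (suc (suc i)) ≤_) (sym (length-rot₁ (a ∷ r))) (s≤s le))) ⟩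
  mergeAt 0 (rotate i (r ++ [ a ])) ∎
  where open Eq.≡-Reasoning

mergeAt-as-rotation : ∀ K i R → length R ≡ suc (suc K) → i < K →
  mergeAt (suc i) R ≡ rotate (K ∸ i) (mergeAt 0 (rotate (suc i) R))
mergeAt-as-rotation K i R eq i<K = begin
  d                                     ≡⟨ rotate-period (suc K) d (length-mergeAt (suc i) R K eq i<K) ⟨
  rotate (suc K) d                      ≡⟨ cong (λ l → rotate l d) (NP.m+[n∸m]≡n {suc i} {suc K} (NP.≤-trans i<K (NP.n≤1+n K))) ⟨
  rotate (suc i + (K ∸ i)) d            ≡⟨ rotate-+ (suc i) (K ∸ i) d ⟩
  rotate (K ∸ i) (rotate (suc i) d)     ≡⟨ cong (rotate (K ∸ i)) (rotate-mergeAt (suc i) R (subst (suc (suc (suc i)) ≤_) (sym eq) (s≤s (s≤s i<K)))) ⟩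
  rotate (K ∸ i) (mergeAt 0 (rotate (suc i) R)) ∎
  where
  open Eq.≡-Reasoning
  d : Word
  d = mergeAt (suc i) R

⟦_⟧ : List Word → Poly
⟦ L ⟧ = map (term 1ℚ 0) L

cyc : (Word → List Word) → Word → List Word
cyc g w = ⋃ (length w) (λ l → g (rotate l w))

-- The summands of C, δ and Σ attached to one rotation (k₁ … kₙ) of the word:
-- z_{k₁+1} z_{k₂} ⋯ z_{kₙ};  z_{k₁+k₂} z_{k₃} ⋯ z_{kₙ};  z_{k₁+1-j} z_{k₂} ⋯ z_{kₙ} z_j (j = t + 1).
Cterm : Word → List Word
Cterm [] = []
Cterm (a ∷ r) = [ suc a ∷ r ]

δterm : Word → List Word
δterm (a ∷ b ∷ r) = [ (a + b) ∷ r ]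
δterm _ = []

splitTerm : ℕ → Word → ℕ → Word
splitTerm a r t = ((a ∸ suc t) + 1) ∷ (r ++ [ suc t ])

Σterms-map : (Word → Word) → Word → List Word
Σterms-map h [] = []
Σterms-map h (a ∷ r) = applyUpTo (h ∘ splitTerm a r) (a ∸ 1)

Σterms : Word → List Word
Σterms = Σterms-map (λ v → v)

Cˡ δˡ Σˡ : Word → List Word
Cˡ = cyc Cterm
δˡ = cyc δterm
Σˡ = cyc Σterms

cycSum-⟦⟧ : ∀ {h : ℕ → Poly} w (g : Word → List Word) → (∀ l → h l ≡ ⟦ g (rot l w) ⟧) →
  concatMap h (upTo (length w)) ≡ ⟦ cyc g w ⟧
cycSum-⟦⟧ {h} w g h≡g = begin
  concat (map h (upTo n))                           ≡⟨ cong concat (LP.map-cong h≡g (upTo n)) ⟩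
  concat (map (λ l → ⟦ g (rot l w) ⟧) (upTo n))     ≡⟨ LP.map-concatMap (term 1ℚ 0) (λ l → g (rot l w)) (upTo n) ⟨
  ⟦ concat (map (λ l → g (rot l w)) (upTo n)) ⟧     ≡⟨ cong (⟦_⟧ ∘ concat) (LP.map-upTo (λ l → g (rot l w)) n) ⟩
  ⟦ ⋃ n (λ l → g (rot l w)) ⟧                       ≡⟨ cong (⟦_⟧ ∘ concat) (applyUpTo-cong n (λ l l<n → cong g (rot≡rotate l w (NP.<⇒≤ l<n)))) ⟩
  ⟦ cyc g w ⟧                                       ∎
  where
  open Eq.≡-Reasoning
  n : ℕ
  n = length w

-- In Defs the summand of each cyclic sum is an anonymous function, which cannot
-- be named in a type; the statements of the summand lemmas below (the summand of
-- the l-th rotation, computed by cases on that rotation) are therefore inferred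
-- from their single use, which is why each pair is declared `mutual`.
mutual
  Cw≡ : ∀ w → Cw w ≡ ⟦ Cˡ w ⟧
  Cw≡ w = cycSum-⟦⟧ w Cterm (Cw-summand w)

  Cw-summand : ∀ w l → _
  Cw-summand w l with rot l w
  ... | []    = Eq.refl
  ... | a ∷ r = Eq.refl

mutual
  δw≡ : ∀ w → δw w ≡ ⟦ δˡ w ⟧
  δw≡ w = cycSum-⟦⟧ w δterm (δw-summand w)

  δw-summand : ∀ w l → _
  δw-summand w l with rot l w
  ... | []        = Eq.refl
  ... | a ∷ []    = Eq.refl
  ... | a ∷ b ∷ r = Eq.refl

Σterms-⟦⟧ : ∀ a r → concatMap (λ i → word↑ (splitTerm a r i)) (upTo (a ∸ 1)) ≡ ⟦ Σterms (a ∷ r) ⟧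
Σterms-⟦⟧ a r = begin
  concat (map (λ i → [ term 1ℚ 0 (splitTerm a r i) ]) (upTo (a ∸ 1)))   ≡⟨ cong concat (LP.map-upTo _ (a ∸ 1)) ⟩
  ⋃ (a ∸ 1) (λ i → [ term 1ℚ 0 (splitTerm a r i) ])                       ≡⟨ ⋃-singletons (a ∸ 1) _ ⟩
  applyUpTo (term 1ℚ 0 ∘ splitTerm a r) (a ∸ 1)                           ≡⟨ LP.map-applyUpTo (splitTerm a r) (term 1ℚ 0) (a ∸ 1) ⟨
  ⟦ applyUpTo (splitTerm a r) (a ∸ 1) ⟧                                  ∎
  where open Eq.≡-Reasoning

mutual
  Σw≡ : ∀ w → Σw w ≡ ⟦ Σˡ w ⟧
  Σw≡ w = cycSum-⟦⟧ w Σterms (Σw-summand w)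

  Σw-summand : ∀ w l → _
  Σw-summand w l with rot l w
  ... | []    = Eq.refl
  ... | a ∷ r = Σterms-⟦⟧ a r

scale-one : ∀ p → scale 1ℚ 0 p ≡ p
scale-one [] = Eq.refl
scale-one (term c e v ∷ p) = cong₂ _∷_ (cong (λ z → term z e v) (QP.*-identityˡ c)) (scale-one p)

linExt-⟦⟧ : (f : Word → Poly) (g : Word → List Word) → (∀ v → f v ≡ ⟦ g v ⟧) → ∀ L → linExt f ⟦ L ⟧ ≡ ⟦ concatMap g L ⟧
linExt-⟦⟧ f g f≡g [] = Eq.refl
linExt-⟦⟧ f g f≡g (v ∷ L) = begin
  scale 1ℚ 0 (f v) ++ linExt f ⟦ L ⟧      ≡⟨ cong₂ _++_ (Eq.trans (scale-one (f v)) (f≡g v)) (linExt-⟦⟧ f g f≡g L) ⟩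
  ⟦ g v ⟧ ++ ⟦ concatMap g L ⟧            ≡⟨ LP.map-++ (term 1ℚ 0) (g v) (concatMap g L) ⟨
  ⟦ g v ++ concatMap g L ⟧                ∎
  where open Eq.≡-Reasoning

St-⟦⟧ : ∀ L → St ⟦ L ⟧ ≡ Stˡ L
St-⟦⟧ [] = Eq.refl
St-⟦⟧ (v ∷ L) = cong₂ _++_ (scale-one (Stw v)) (St-⟦⟧ L)

C-⟦⟧ : ∀ L → C ⟦ L ⟧ ≡ ⟦ concatMap Cˡ L ⟧
C-⟦⟧ = linExt-⟦⟧ Cw Cˡ Cw≡

Σ-⟦⟧ : ∀ L → Σ ⟦ L ⟧ ≡ ⟦ concatMap Σˡ L ⟧
Σ-⟦⟧ = linExt-⟦⟧ Σw Σˡ Σw≡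

δ-⟦⟧ : ∀ L → δ ⟦ L ⟧ ≡ ⟦ concatMap δˡ L ⟧
δ-⟦⟧ = linExt-⟦⟧ δw δˡ δw≡

concatMap-⋃ : ∀ {A B : Set} (f : A → List B) n (g : ℕ → List A) → concatMap f (⋃ n g) ≡ ⋃ n (λ j → concatMap f (g j))
concatMap-⋃ f zero g = Eq.refl
concatMap-⋃ f (suc n) g = Eq.trans (LP.concatMap-++ f (g 0) (⋃ n (g ∘ suc))) (cong (concatMap f (g 0) ++_) (concatMap-⋃ f n (g ∘ suc)))

concatMap-applyUpTo : ∀ {A B : Set} (f : A → List B) n (g : ℕ → A) → concatMap f (applyUpTo g n) ≡ ⋃ n (λ j → f (g j))
concatMap-applyUpTo f n g = cong concat (LP.map-applyUpTo g f n)

cyc-unfold : ∀ g x m → length x ≡ suc m → cyc g x ≡ g x ++ ⋃ m (λ q → g (rotate (suc q) x))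
cyc-unfold g x m len = cong (λ n → ⋃ n (λ l → g (rotate l x))) len

raise : Word → Word
raise [] = []
raise (a ∷ r) = suc a ∷ r

Cterm-nonempty : ∀ x m → length x ≡ suc m → Cterm x ≡ [ raise x ]
Cterm-nonempty (a ∷ r) m _ = Eq.refl

merges-raise : ∀ x → merges (raise x) ≡ map raise (merges x)
merges-raise [] = Eq.refl
merges-raise (a ∷ r) = Eq.trans (applyUpTo-cong (length r) (λ i _ → mergeAt-raise i (a ∷ r)))
                                (sym (LP.map-applyUpTo (λ i → mergeAt i (a ∷ r)) raise (length r)))
  where
  mergeAt-raise : ∀ i x → mergeAt i (raise x) ≡ raise (mergeAt i x)
  mergeAt-raise zero [] = Eq.refl
  mergeAt-raise zero (a ∷ []) = Eq.refl
  mergeAt-raise zero (a ∷ b ∷ r) = Eq.refl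
  mergeAt-raise (suc i) [] = Eq.refl
  mergeAt-raise (suc i) (a ∷ r) = Eq.refl

module LongWord (K : ℕ) (w : Word) (len : length w ≡ suc (suc K)) where

  n : ℕ
  n = suc (suc K)

  R D : ℕ → Word
  R j = rotate j w
  D m = mergeAt 0 (R m)

  length-R : ∀ j → length (R j) ≡ n
  length-R j = Eq.trans (length-rotate j w) len

  length-D : ∀ m → length (D m) ≡ suc K
  length-D m = length-mergeAt 0 (R m) K (length-R m) z≤n

  R-periodic : ∀ m → R (m + n) ≡ R m
  R-periodic m = Eq.trans (rotate-+ m n w) (rotate-period n (R m) (length-R m))

  R-n : R n ≡ R 0
  R-n = rotate-period n w len

  cyc-w : ∀ g → cyc g w ≡ ⋃ n (λ j → g (R j))
  cyc-w g = cong (λ l → ⋃ l (λ j → g (R j))) len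

  δˡ-w : δˡ w ≡ applyUpTo D n
  δˡ-w = Eq.trans (cyc-w δterm) (Eq.trans (cong concat (applyUpTo-cong n (λ j _ → first-pair (R j) (length-R j)))) (⋃-singletons n D))
    where
    first-pair : ∀ x → length x ≡ n → δterm x ≡ [ mergeAt 0 x ]
    first-pair (a ∷ b ∷ r) _ = Eq.refl

  merges-R : ∀ j → merges (R j) ≡ D j ∷ applyUpTo (λ i → mergeAt (suc i) (R j)) K
  merges-R j = cong (λ l → applyUpTo (λ i → mergeAt i (R j)) (pred l)) (length-R j)

  -- Writing merge_{i+1}(Rⱼ) as
  -- rot^{K-i}(D_{j+i+1}), this is the exchange of a double sum, a cyclic shift
  -- j ↦ j + i + 1 of ℤ/n, and the reversal i ↦ K - i.
  interior-merges : (F : Word → List Word) →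
    ⋃ n (λ j → ⋃ K (λ i → F (mergeAt (suc i) (R j)))) ↭ ⋃ n (λ m → ⋃ K (λ q → F (rotate (suc q) (D m))))
  interior-merges F = begin
    ⋃ n (λ j → ⋃ K (λ i → F (mergeAt (suc i) (R j))))     ≡⟨ cong concat (applyUpTo-cong n (λ j _ → cong concat (applyUpTo-cong K (λ i i<K → cong F (as-rotation j i i<K))))) ⟩
    ⋃ n (λ j → ⋃ K (λ i → H (j + suc i) (K ∸ i)))         ↭⟨ ⋃-swap n K (λ j i → H (j + suc i) (K ∸ i)) ⟩
    ⋃ K (λ i → ⋃ n (λ j → H (j + suc i) (K ∸ i)))         ↭⟨ ⋃-cong K (λ i _ → ⋃-rotate n (λ m → H m (K ∸ i)) (λ m → cong (λ x → F (rotate (K ∸ i) (mergeAt 0 x))) (R-periodic m)) (suc i)) ⟩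
    ⋃ K (λ i → ⋃ n (λ m → H m (K ∸ i)))                   ↭⟨ ⋃-swap K n (λ i m → H m (K ∸ i)) ⟩
    ⋃ n (λ m → ⋃ K (λ i → H m (K ∸ i)))                   ↭⟨ ⋃-cong n (λ m _ → ⋃-reverse K (H m)) ⟩
    ⋃ n (λ m → ⋃ K (λ q → H m (suc q)))                   ∎
    where
    open PermutationReasoning
    H : ℕ → ℕ → List Word
    H m q = F (rotate q (D m))
    as-rotation : ∀ j i → i < K → mergeAt (suc i) (R j) ≡ rotate (K ∸ i) (D (j + suc i))
    as-rotation j i i<K = Eq.trans (mergeAt-as-rotation K i (R j) (length-R j) i<K)
                                   (cong (λ x → rotate (K ∸ i) (mergeAt 0 x)) (sym (rotate-+ j (suc i) w)))

  merges-cyc : ∀ g → concatMap merges (cyc g w) ≡ ⋃ n (λ j → concatMap merges (g (R j)))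
  merges-cyc g = Eq.trans (cong (concatMap merges) (cyc-w g)) (concatMap-⋃ merges n (λ j → g (R j)))

  cyc-δ : ∀ g → concatMap (cyc g) (δˡ w) ≡ ⋃ n (λ m → g (D m) ++ ⋃ K (λ q → g (rotate (suc q) (D m))))
  cyc-δ g = Eq.trans (cong (concatMap (cyc g)) δˡ-w)
    (Eq.trans (concatMap-applyUpTo (cyc g) n D)
      (cong concat (applyUpTo-cong n (λ m _ → cyc-unfold g (D m) K (length-D m)))))

  merges-Cterm : ∀ j → concatMap merges (Cterm (R j)) ≡ Cterm (D j) ++ ⋃ K (λ i → Cterm (mergeAt (suc i) (R j)))
  merges-Cterm j = begin
    concatMap merges (Cterm (R j))               ≡⟨ cong (concatMap merges) (Cterm-nonempty (R j) (suc K) (length-R j)) ⟩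
    merges (raise (R j)) ++ []                   ≡⟨ LP.++-identityʳ _ ⟩
    merges (raise (R j))                         ≡⟨ merges-raise (R j) ⟩
    map raise (merges (R j))                     ≡⟨ cong (map raise) (merges-R j) ⟩
    raise (D j) ∷ map raise (applyUpTo interior K)     ≡⟨ cong (raise (D j) ∷_) (LP.map-applyUpTo interior raise K) ⟩
    raise (D j) ∷ applyUpTo (raise ∘ interior) K       ≡⟨ cong (raise (D j) ∷_) (⋃-singletons K (raise ∘ interior)) ⟨
    [ raise (D j) ] ++ ⋃ K (λ i → [ raise (interior i) ])
       ≡⟨ cong₂ _++_ (sym (Cterm-nonempty (D j) K (length-D j)))
                     (cong concat (applyUpTo-cong K (λ i i<K → sym (Cterm-nonempty (interior i) K
                        (length-mergeAt (suc i) (R j) K (length-R j) i<K))))) ⟩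
    Cterm (D j) ++ ⋃ K (λ i → Cterm (interior i))  ∎
    where
    open Eq.≡-Reasoning
    interior : ℕ → Word
    interior i = mergeAt (suc i) (R j)

  C-identity : concatMap merges (Cˡ w) ↭ concatMap Cˡ (δˡ w)
  C-identity = begin
    concatMap merges (Cˡ w)                                        ≡⟨ merges-cyc Cterm ⟩
    ⋃ n (λ j → concatMap merges (Cterm (R j)))                     ≡⟨ cong concat (applyUpTo-cong n (λ j _ → merges-Cterm j)) ⟩
    ⋃ n (λ j → Cterm (D j) ++ interiorC j)                         ↭⟨ ⋃-++ n (Cterm ∘ D) interiorC ⟩
    ⋃ n (Cterm ∘ D) ++ ⋃ n interiorC                               ↭⟨ PermP.++⁺ˡ (⋃ n (Cterm ∘ D)) (interior-merges Cterm) ⟩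
    ⋃ n (Cterm ∘ D) ++ ⋃ n rotatedC                                ↭⟨ ⋃-++ n (Cterm ∘ D) rotatedC ⟨
    ⋃ n (λ m → Cterm (D m) ++ rotatedC m)                          ≡⟨ cyc-δ Cterm ⟨
    concatMap Cˡ (δˡ w)                                            ∎
    where
    open PermutationReasoning
    interiorC rotatedC : ℕ → List Word
    interiorC j = ⋃ K (λ i → Cterm (mergeAt (suc i) (R j)))
    rotatedC m = ⋃ K (λ q → Cterm (rotate (suc q) (D m)))

  firstΣ lastΣ interiorΣ : Word → List Word
  firstΣ = Σterms-map (mergeAt 0)
  lastΣ = Σterms-map (mergeAt (suc K))
  interiorΣ x = ⋃ K (λ i → Σterms (mergeAt (suc i) x))

  merges-Σterms : ∀ x → length x ≡ n → concatMap merges (Σterms x) ↭ firstΣ x ++ (interiorΣ x ++ lastΣ x)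
  merges-Σterms (a ∷ b ∷ r) eq = begin
    concatMap merges (applyUpTo s p)                               ≡⟨ concatMap-applyUpTo merges p s ⟩
    ⋃ p (λ t → merges (s t))                                       ≡⟨ cong concat (applyUpTo-cong p (λ t _ → all-merges t)) ⟩
    ⋃ p (λ t → ⋃ n (λ i → [ mergeAt i (s t) ]))                    ↭⟨ ⋃-swap p n (λ t i → [ mergeAt i (s t) ]) ⟩
    ⋃ n (λ i → ⋃ p (λ t → [ mergeAt i (s t) ]))                    ≡⟨ cong concat (applyUpTo-cong n (λ i _ → ⋃-singletons p (λ t → mergeAt i (s t)))) ⟩
    h 0 ++ ⋃ (suc K) (h ∘ suc)                                     ≡⟨ cong (h 0 ++_) (⋃-snoc K (h ∘ suc)) ⟩
    h 0 ++ (⋃ K (h ∘ suc) ++ h (suc K))                            ≡⟨ cong (λ z → h 0 ++ (concat z ++ h (suc K))) (applyUpTo-cong K interior) ⟩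
    firstΣ (a ∷ b ∷ r) ++ (interiorΣ (a ∷ b ∷ r) ++ lastΣ (a ∷ b ∷ r))  ∎
    where
    open PermutationReasoning
    p : ℕ
    p = a ∸ 1
    s : ℕ → Word
    s = splitTerm a (b ∷ r)
    h : ℕ → List Word
    h i = applyUpTo (λ t → mergeAt i (s t)) p
    length-r : length r ≡ K
    length-r = NP.suc-injective (NP.suc-injective eq)
    all-merges : ∀ t → merges (s t) ≡ ⋃ n (λ i → [ mergeAt i (s t) ])
    all-merges t = Eq.trans
      (cong (applyUpTo (λ i → mergeAt i (s t))) (Eq.trans (LP.length-++ (b ∷ r)) (cong suc (Eq.trans (NP.+-comm (length r) 1) (cong suc length-r)))))
      (sym (⋃-singletons n (λ i → mergeAt i (s t))))
    interior : ∀ i → i < K → h (suc i) ≡ Σterms (mergeAt (suc i) (a ∷ b ∷ r))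
    interior i i<K = applyUpTo-cong p (λ t _ → cong ((a ∸ suc t) + 1 ∷_)
      (mergeAt-++ i (b ∷ r) [ suc t ] (s≤s (subst (suc i ≤_) (sym length-r) i<K))))

  -- The Σ-summands z_{a+b-j} r z_j of merge₀(z_a z_b r) = z_{a+b} r, split by
  -- j < a, j = a and j > a: front merges of Σ-summands of x, the C-summand of the
  -- rotation rot₁ x = z_b r z_a, and last merges of Σ-summands of rot₁ x.
  Σterms-merge₀ : ∀ x → length x ≡ n → All (1 ≤_) x →
    Σterms (mergeAt 0 x) ≡ firstΣ x ++ (raise (rot₁ x) ∷ lastΣ (rot₁ x))
  Σterms-merge₀ (suc a ∷ suc b ∷ r) eq (s≤s z≤n All.∷ s≤s z≤n All.∷ _) = begin
    applyUpTo f (a + suc b)                                       ≡⟨ applyUpTo-+ a (suc b) f ⟩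
    applyUpTo f a ++ f (a + 0) ∷ applyUpTo (λ t → f (a + suc t)) b
      ≡⟨ cong₂ _++_ (applyUpTo-cong a front) (cong₂ _∷_ middle (applyUpTo-cong b back)) ⟩
    firstΣ x ++ (raise (rot₁ x) ∷ lastΣ (rot₁ x))                 ∎
    where
    open Eq.≡-Reasoning
    x : Word
    x = suc a ∷ suc b ∷ r
    f : ℕ → Word
    f = splitTerm (suc a + suc b) r
    length-r : length r ≡ K
    length-r = NP.suc-injective (NP.suc-injective eq)
    front : ∀ t → t < a → f t ≡ mergeAt 0 (splitTerm (suc a) (suc b ∷ r) t)
    front t t<a = cong (_∷ (r ++ [ suc t ])) (begin
      (a + suc b ∸ t) + 1       ≡⟨ cong (_+ 1) (NP.+-∸-comm (suc b) (NP.<⇒≤ t<a)) ⟩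
      (a ∸ t + suc b) + 1       ≡⟨ NP.+-assoc (a ∸ t) (suc b) 1 ⟩
      a ∸ t + (suc b + 1)       ≡⟨ cong (a ∸ t +_) (NP.+-comm (suc b) 1) ⟩
      a ∸ t + (1 + suc b)       ≡⟨ NP.+-assoc (a ∸ t) 1 (suc b) ⟨
      (a ∸ t + 1) + suc b       ∎)
    middle : f (a + 0) ≡ raise (rot₁ x)
    middle = Eq.trans (cong f (NP.+-identityʳ a))
      (cong (_∷ (r ++ [ suc a ])) (Eq.trans (cong (_+ 1) (NP.m+n∸m≡n a (suc b))) (NP.+-comm (suc b) 1)))
    back : ∀ t → t < b → f (a + suc t) ≡ mergeAt (suc K) (splitTerm (suc b) (r ++ [ suc a ]) t)
    back t _ = cong₂ _∷_ (cong (_+ 1) (NP.[m+n]∸[m+o]≡n∸o a (suc b) (suc t))) (sym (begin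
      mergeAt K ((r ++ [ suc a ]) ++ [ suc t ])  ≡⟨ cong (mergeAt K) (LP.++-assoc r [ suc a ] [ suc t ]) ⟩
      mergeAt K (r ++ suc a ∷ suc t ∷ [])        ≡⟨ cong (λ l → mergeAt l (r ++ suc a ∷ suc t ∷ [])) length-r ⟨
      mergeAt (length r) (r ++ suc a ∷ suc t ∷ [])  ≡⟨ mergeAt-last r (suc a) (suc t) [] ⟩
      r ++ [ suc a + suc t ]                     ∎))

  -- Front merges and interior merges match
  -- directly (Σterms-merge₀, interior-merges); the C-summands and the last merges
  -- match after the shift j ↦ j + 1.
  Σ-identity : All (1 ≤_) w → concatMap merges (Σˡ w) ++ Cˡ w ↭ concatMap Σˡ (δˡ w)
  Σ-identity positive = begin
    concatMap merges (Σˡ w) ++ Cˡ w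
      ≡⟨ cong₂ _++_ (merges-cyc Σterms) (Eq.trans (cyc-w Cterm) (Eq.trans (cong concat (applyUpTo-cong n C-summand)) (⋃-singletons n raisedR))) ⟩
    ⋃ n (λ j → concatMap merges (Σterms (R j))) ++ applyUpTo raisedR n
      ↭⟨ PermP.++⁺ʳ (applyUpTo raisedR n) (⋃-cong n (λ j _ → merges-Σterms (R j) (length-R j))) ⟩
    ⋃ n (λ j → firstΣ (R j) ++ (interiorΣ (R j) ++ lastΣ (R j))) ++ applyUpTo raisedR n
      ↭⟨ PermP.++⁺ʳ (applyUpTo raisedR n) (split₃ (firstΣ ∘ R) (interiorΣ ∘ R) (lastΣ ∘ R)) ⟩
    (⋃ n (firstΣ ∘ R) ++ (⋃ n (interiorΣ ∘ R) ++ ⋃ n (lastΣ ∘ R))) ++ applyUpTo raisedR n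
      ↭⟨ regroup (⋃ n (firstΣ ∘ R)) (⋃ n (interiorΣ ∘ R)) (⋃ n (lastΣ ∘ R)) (applyUpTo raisedR n) ⟩
    (⋃ n (firstΣ ∘ R) ++ (applyUpTo raisedR n ++ ⋃ n (lastΣ ∘ R))) ++ ⋃ n (interiorΣ ∘ R)
      ↭⟨ PermP.++⁺ (PermP.++⁺ˡ (⋃ n (firstΣ ∘ R)) (PermP.++⁺ raised-shift last-shift)) (interior-merges Σterms) ⟩
    (⋃ n (firstΣ ∘ R) ++ (⋃ n (λ m → [ raisedR (suc m) ]) ++ ⋃ n (lastΣ ∘ R ∘ suc))) ++ ⋃ n rotatedΣ
      ↭⟨ ↭-sym (split₄ (firstΣ ∘ R) (λ m → [ raisedR (suc m) ]) (lastΣ ∘ R ∘ suc) rotatedΣ) ⟩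
    ⋃ n (λ m → (firstΣ (R m) ++ (raisedR (suc m) ∷ lastΣ (R (suc m)))) ++ rotatedΣ m)
      ≡⟨ cong concat (applyUpTo-cong n (λ m _ → cong (_++ rotatedΣ m) (sym (Σterms-D m)))) ⟩
    ⋃ n (λ m → Σterms (D m) ++ rotatedΣ m)
      ≡⟨ cyc-δ Σterms ⟨
    concatMap Σˡ (δˡ w)   ∎
    where
    open PermutationReasoning
    raisedR : ℕ → Word
    raisedR j = raise (R j)
    rotatedΣ : ℕ → List Word
    rotatedΣ m = ⋃ K (λ q → Σterms (rotate (suc q) (D m)))
    C-summand : ∀ j → j < n → Cterm (R j) ≡ [ raisedR j ]
    C-summand j _ = Cterm-nonempty (R j) (suc K) (length-R j)
    Σterms-D : ∀ m → Σterms (D m) ≡ firstΣ (R m) ++ (raisedR (suc m) ∷ lastΣ (R (suc m)))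
    Σterms-D m = Eq.trans (Σterms-merge₀ (R m) (length-R m) (All-rotate m w positive))
      (cong (λ y → firstΣ (R m) ++ (raise y ∷ lastΣ y)) (sym (rotate-suc m w)))
    raised-shift : applyUpTo raisedR n ↭ ⋃ n (λ m → [ raisedR (suc m) ])
    raised-shift = ↭-sym (↭-trans (↭-reflexive (⋃-singletons n (raisedR ∘ suc)))
                                  (applyUpTo-shift₁ n raisedR (cong raise R-n)))
    last-shift : ⋃ n (lastΣ ∘ R) ↭ ⋃ n (lastΣ ∘ R ∘ suc)
    last-shift = ↭-sym (concat-↭ (applyUpTo-shift₁ n (lastΣ ∘ R) (cong lastΣ R-n)))
    split₃ : (a b c : ℕ → List Word) → ⋃ n (λ j → a j ++ (b j ++ c j)) ↭ ⋃ n a ++ (⋃ n b ++ ⋃ n c)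
    split₃ a b c = ↭-trans (⋃-++ n a (λ j → b j ++ c j)) (PermP.++⁺ˡ (⋃ n a) (⋃-++ n b c))
    split₄ : (a b c d : ℕ → List Word) →
      ⋃ n (λ j → (a j ++ (b j ++ c j)) ++ d j) ↭ (⋃ n a ++ (⋃ n b ++ ⋃ n c)) ++ ⋃ n d
    split₄ a b c d = ↭-trans (⋃-++ n (λ j → a j ++ (b j ++ c j)) d) (PermP.++⁺ʳ (⋃ n d) (split₃ a b c))
    regroup : (E M L I : List Word) → (E ++ (M ++ L)) ++ I ↭ (E ++ (I ++ L)) ++ M
    regroup E M L I = begin
      (E ++ (M ++ L)) ++ I   ↭⟨ PermP.++-assoc E (M ++ L) I ⟩
      E ++ ((M ++ L) ++ I)   ↭⟨ PermP.++⁺ˡ E (PermP.++-comm (M ++ L) I) ⟩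
      E ++ (I ++ (M ++ L))   ↭⟨ PermP.++⁺ˡ E (PermP.++⁺ˡ I (PermP.++-comm M L)) ⟩
      E ++ (I ++ (L ++ M))   ↭⟨ PermP.++⁺ˡ E (PermP.++-assoc I L M) ⟨
      E ++ ((I ++ L) ++ M)   ↭⟨ PermP.++-assoc E (I ++ L) M ⟨
      (E ++ (I ++ L)) ++ M   ∎

Stˡ-↭ : ∀ {L L′} → L ↭ L′ → Stˡ L ↭ Stˡ L′
Stˡ-↭ p = concat-↭ (PermP.map⁺ Stw p)

≋-subtract : ∀ {p q r} → p ++ q ≋ r → p ≋ r ⊖ q
≋-subtract {p} {q} {r} (coeffwise eq) = coeffwise λ m u → begin
  coeff p m u                                                ≡⟨ solve 2 (λ a b → a := (a :+ b) :+ con (ℚ.- 1ℚ) :* b) Eq.refl (coeff p m u) (coeff q m u) ⟩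
  (coeff p m u ℚ.+ coeff q m u) ℚ.+ (ℚ.- 1ℚ) ℚ.* coeff q m u ≡⟨ cong (ℚ._+ (ℚ.- 1ℚ) ℚ.* coeff q m u) (Eq.trans (sym (coeff-++ p q m u)) (eq m u)) ⟩
  coeff r m u ℚ.+ (ℚ.- 1ℚ) ℚ.* coeff q m u                   ≡⟨ cong (coeff r m u ℚ.+_) (coeff-scale (ℚ.- 1ℚ) q m u) ⟨
  coeff r m u ℚ.+ coeff (scale (ℚ.- 1ℚ) 0 q) m u             ≡⟨ coeff-++ r (scale (ℚ.- 1ℚ) 0 q) m u ⟨
  coeff (r ⊖ q) m u                                          ∎
  where
  open Eq.≡-Reasoning
  open +-*-Solver

Stˡ-copies : ∀ N x → Stˡ (applyUpTo (λ _ → x) N) ≋ scale (ℕ→ℚ N) 0 (Stw x)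
Stˡ-copies N x = coeffwise λ m u → Eq.trans (copies N m u) (sym (coeff-scale (ℕ→ℚ N) (Stw x) m u))
  where
  open +-*-Solver
  copies : ∀ N m u → coeff (Stˡ (applyUpTo (λ _ → x) N)) m u ≡ ℕ→ℚ N ℚ.* coeff (Stw x) m u
  copies zero m u = sym (QP.*-zeroˡ (coeff (Stw x) m u))
  copies (suc N) m u = begin
    coeff (Stw x ++ Stˡ (applyUpTo (λ _ → x) N)) m u         ≡⟨ coeff-++ (Stw x) _ m u ⟩
    c ℚ.+ coeff (Stˡ (applyUpTo (λ _ → x) N)) m u            ≡⟨ cong (c ℚ.+_) (copies N m u) ⟩
    c ℚ.+ ℕ→ℚ N ℚ.* c                                        ≡⟨ solve 2 (λ c n → c :+ n :* c := (con 1ℚ :+ n) :* c) Eq.refl c (ℕ→ℚ N) ⟩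
    (1ℚ ℚ.+ ℕ→ℚ N) ℚ.* c                                     ≡⟨ cong (ℚ._* c) (ℕ→ℚ-suc N) ⟨
    ℕ→ℚ (suc N) ℚ.* c                                        ∎
    where
    open Eq.≡-Reasoning
    c : ℚ
    c = coeff (Stw x) m u

St-lin : (X : Poly → Poly) (g : Word → List Word) → (∀ L → X ⟦ L ⟧ ≡ ⟦ concatMap g L ⟧) →
  ∀ L → St (X ⟦ L ⟧) ≡ Stˡ (concatMap g L)
St-lin X g X≡g L = Eq.trans (cong St (X≡g L)) (St-⟦⟧ (concatMap g L))

St-C : ∀ w → St (C (word↑ w)) ≡ Stˡ (Cˡ w)
St-C w = Eq.trans (St-lin C Cˡ C-⟦⟧ [ w ]) (cong Stˡ (LP.++-identityʳ (Cˡ w)))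

St-Σ : ∀ w → St (Σ (word↑ w)) ≡ Stˡ (Σˡ w)
St-Σ w = Eq.trans (St-lin Σ Σˡ Σ-⟦⟧ [ w ]) (cong Stˡ (LP.++-identityʳ (Σˡ w)))

δ-word : ∀ w → δ (word↑ w) ≡ ⟦ δˡ w ⟧
δ-word w = Eq.trans (δ-⟦⟧ [ w ]) (cong ⟦_⟧ (LP.++-identityʳ (δˡ w)))

St-C-δ : ∀ w → St (C (δ (word↑ w))) ≡ Stˡ (concatMap Cˡ (δˡ w))
St-C-δ w = Eq.trans (cong (St ∘ C) (δ-word w)) (St-lin C Cˡ C-⟦⟧ (δˡ w))

St-Σ-δ : ∀ w → St (Σ (δ (word↑ w))) ≡ Stˡ (concatMap Σˡ (δˡ w))
St-Σ-δ w = Eq.trans (cong (St ∘ Σ) (δ-word w)) (St-lin Σ Σˡ Σ-⟦⟧ (δˡ w))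

ddt-St-C : ∀ w → ddt (St (C (word↑ w))) ≋ Stˡ (concatMap merges (Cˡ w))
ddt-St-C w = ≋-trans (≡⇒≋ (cong ddt (St-C w))) (ddt-Stˡ (Cˡ w))

ddt-St-Σ : ∀ w → ddt (St (Σ (word↑ w))) ≋ Stˡ (concatMap merges (Σˡ w))
ddt-St-Σ w = ≋-trans (≡⇒≋ (cong ddt (St-Σ w))) (ddt-Stˡ (Σˡ w))

merges-Σˡ-letter : ∀ k → concatMap merges (Σˡ (k ∷ [])) ≡ applyUpTo (λ _ → suc k ∷ []) (k ∸ 1)
merges-Σˡ-letter k = begin
  concatMap merges (Σterms (k ∷ []) ++ [])                     ≡⟨ cong (concatMap merges) (LP.++-identityʳ (Σterms (k ∷ []))) ⟩
  concatMap merges (applyUpTo (splitTerm k []) (k ∸ 1))        ≡⟨ concatMap-applyUpTo merges (k ∸ 1) (splitTerm k []) ⟩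
  ⋃ (k ∸ 1) (λ t → [ (k ∸ suc t) + 1 + suc t ∷ [] ])           ≡⟨ ⋃-singletons (k ∸ 1) _ ⟩
  applyUpTo (λ t → (k ∸ suc t) + 1 + suc t ∷ []) (k ∸ 1)       ≡⟨ applyUpTo-cong (k ∸ 1) (λ t t<k-1 → cong (_∷ []) (letters t t<k-1)) ⟩
  applyUpTo (λ _ → suc k ∷ []) (k ∸ 1)                          ∎
  where
  open Eq.≡-Reasoning
  letters : ∀ t → t < k ∸ 1 → (k ∸ suc t) + 1 + suc t ≡ suc k
  letters t t<k-1 = Eq.trans (NP.+-assoc (k ∸ suc t) 1 (suc t))
    (Eq.trans (NP.+-suc (k ∸ suc t) (suc t)) (cong suc (NP.m∸n+n≡m (NP.≤-trans t<k-1 (NP.m∸n≤m k 1)))))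

ddt-St-Σ-letter : ∀ k → ddt (St (Σ (word↑ (k ∷ [])))) ≋ term (ℕ→ℚ (sum (k ∷ []) ∸ 1)) 0 ((sum (k ∷ []) + 1) ∷ []) ∷ []
ddt-St-Σ-letter k = begin
  ddt (St (Σ (word↑ (k ∷ []))))                    ≈⟨ ddt-St-Σ (k ∷ []) ⟩
  Stˡ (concatMap merges (Σˡ (k ∷ [])))             ≡⟨ cong Stˡ (merges-Σˡ-letter k) ⟩
  Stˡ (applyUpTo (λ _ → suc k ∷ []) (k ∸ 1))       ≈⟨ Stˡ-copies (k ∸ 1) (suc k ∷ []) ⟩
  [ term (ℕ→ℚ (k ∸ 1) ℚ.* 1ℚ) 0 (suc k ∷ []) ]     ≡⟨ cong₂ (λ c a → [ term c 0 (a ∷ []) ])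
                                                         (Eq.trans (QP.*-identityʳ _) (cong (λ s → ℕ→ℚ (s ∸ 1)) (sym (NP.+-identityʳ k))))
                                                         (Eq.trans (NP.+-comm 1 k) (cong (_+ 1) (sym (NP.+-identityʳ k)))) ⟩
  [ term (ℕ→ℚ (sum (k ∷ []) ∸ 1)) 0 ((sum (k ∷ []) + 1) ∷ []) ]  ∎
  where open SetoidReasoning ≋-setoid

lemma5p5 : (w : List ℕ) → All (1 ≤_) w → 1 ≤ length w →
    (length w ≡ 1 →
        (ddt (St (C (word↑ w))) ≈ zeroP)
      × (ddt (St (Σ (word↑ w))) ≈ term (ℕ→ℚ (sum w ∸ 1)) 0 ((sum w + 1) ∷ []) ∷ []))
    × (2 ≤ length w →
        (ddt (St (C (word↑ w))) ≈ St (C (δ (word↑ w))))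
      × (ddt (St (Σ (word↑ w))) ≈ St (Σ (δ (word↑ w))) ⊖ St (C (word↑ w))))
lemma5p5 [] _ ()
lemma5p5 (k ∷ []) _ _ = (λ _ → coeffs (ddt-St-C (k ∷ [])) , coeffs (ddt-St-Σ-letter k)) , λ { (s≤s ()) }
lemma5p5 w@(_ ∷ _ ∷ r) positive _ = (λ ()) , λ _ → coeffs C-case , coeffs Σ-case
  where
  open LongWord (length r) w Eq.refl
  C-case : ddt (St (C (word↑ w))) ≋ St (C (δ (word↑ w)))
  C-case = begin
    ddt (St (C (word↑ w)))              ≈⟨ ddt-St-C w ⟩
    Stˡ (concatMap merges (Cˡ w))       ≈⟨ ↭⇒≋ (Stˡ-↭ C-identity) ⟩
    Stˡ (concatMap Cˡ (δˡ w))           ≡⟨ St-C-δ w ⟨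
    St (C (δ (word↑ w)))                ∎
    where open SetoidReasoning ≋-setoid
  Σ-case : ddt (St (Σ (word↑ w))) ≋ St (Σ (δ (word↑ w))) ⊖ St (C (word↑ w))
  Σ-case = ≋-trans (ddt-St-Σ w) (≋-subtract (begin
    Stˡ (concatMap merges (Σˡ w)) ++ St (C (word↑ w))   ≡⟨ cong (Stˡ (concatMap merges (Σˡ w)) ++_) (St-C w) ⟩
    Stˡ (concatMap merges (Σˡ w)) ++ Stˡ (Cˡ w)         ≡⟨ LP.concatMap-++ Stw (concatMap merges (Σˡ w)) (Cˡ w) ⟨
    Stˡ (concatMap merges (Σˡ w) ++ Cˡ w)               ≈⟨ ↭⇒≋ (Stˡ-↭ (Σ-identity positive)) ⟩
    Stˡ (concatMap Σˡ (δˡ w))                           ≡⟨ St-Σ-δ w ⟨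
    St (Σ (δ (word↑ w)))                                ∎))
    where open SetoidReasoning ≋-setoid
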